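{- For every integer $n\ge0$ let $g_n\in\{0,1\}$ be the parity of the number of digits equal to $1$ in the negabinary representation of $n$ (the unique representation $n=\sum_{i\ge0}d_i(-2)^i$ with $d_i\in\{0,1\}$). Then the infinite sequence $G=(g_n)_{n\ge0}$ is cube-free: there is no nonempty finite word $X$ over $\{0,1\}$ such that $XXX$ occurs in $G$ as a block of consecutive terms. -}

module Defs where

open import Data.Nat using (ℕ; zero; suc; _+_; _*_; _/_; _%_)
open import Data.Bool using (Bool; true; false; _xor_)
open import Data.List using (List; []; _∷_)
open import Data.Integer as ℤ using (ℤ)

negaValue : List Bool → ℤ
negaValue []          = ℤ.0ℤ
negaValue (d ∷ ds) = (if-bit d) ℤ.+ (ℤ.-[1+ 1 ] ℤ.* negaValue ds)
  where
  if-bit : Bool → ℤ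
  if-bit true  = ℤ.1ℤ
  if-bit false = ℤ.0ℤ

-- Standard negabinary digit-extraction algorithm (least significant first),
-- with fuel to make termination structural.
--   posDigits k n : digits of  n  (n ≥ 0)
--   negDigits k m : digits of -m  (m ≥ 0)
-- For  n : the last digit is d = n mod 2 and the rest represents
-- (n - d)/(-2) = -((n - d)/2).  For -m : d = m mod 2 and the rest represents
-- (-m - d)/(-2) = (m + d)/2.
bit : ℕ → Bool
bit n with n % 2
... | zero = false
... | suc _ = true

posDigits negDigits : ℕ → ℕ → List Bool
posDigits zero    n       = []
posDigits (suc k) zero    = []
posDigits (suc k) (suc n) = bit (suc n) ∷ negDigits k (suc n / 2)
negDigits zero    m       = []
negDigits (suc k) zero    = []
negDigits (suc k) (suc m) = bit (suc m) ∷ posDigits k ((suc m + (suc m % 2)) / 2)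

-- Negabinary representation of n (fuel 2n+2 is more than enough; the
-- representation length is O(log n)).
negabinary : ℕ → List Bool
negabinary n = posDigits (suc (n + n)) n

parityOnes : List Bool → Bool
parityOnes []       = false
parityOnes (d ∷ ds) = d xor parityOnes ds

g : ℕ → Bool
g n = parityOnes (negabinary n)

-- Splitting n by parity, one step of the negabinary digit algorithm gives
--   g (2a) = g⁻ a,   g (2a+1) = ¬ g⁻ a,   g⁻ (2a) = g a,   g⁻ (2a+1) = ¬ g (a+1),
-- where g⁻ m is the digit parity of −m.  Each of g, g⁻ is thus the image of the
-- other under the Thue–Morse substitution b ↦ b ¬b (shifted by one for g⁻), and
-- the classical argument for the Thue–Morse word applies: along an overlap of
-- odd period the blocks b ¬b force the word to alternate for a whole period,
-- which contradicts periodicity, while an overlap of even period 2a of one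
-- sequence restricts to an overlap of period a of the other.  So g is even
-- overlap-free, and a cube XXX contains an overlap of period |X|.
module Submission where

open import Defs
open import Data.Nat using (ℕ; suc; _+_)
open import Data.Bool using (Bool)
open import Data.Fin using (Fin; toℕ)
open import Data.Vec using (Vec; lookup; _++_)
open import Relation.Nullary using (¬_)
open import Relation.Binary.PropositionalEquality using (_≡_)

open import Data.Nat using (zero; _*_; _/_; _%_; _≤_; _<_; z≤n; s≤s; z<s)
open import Data.Nat.Properties
  using (≤-refl; ≤-trans; ≤-reflexive; <⇒≤; n≤1+n; m≤m+n; m≤n+m; m+n≤o⇒n≤o; m≤m*n; m<m*n;
         *-monoˡ-≤; m≤n⇒m<n∨m≡n; +-identityʳ; +-suc; +-assoc; +-comm; *-comm; *-distribʳ-+)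
open import Data.Nat.Divisibility using (divides-refl)
open import Data.Nat.DivMod using (m*n/n≡m; m*n%n≡0; [m+kn]%n≡m%n; +-distrib-/-∣ʳ)
open import Data.Nat.Induction using (<-wellFounded)
open import Data.Nat.Tactic.RingSolver using (solve-∀)
open import Data.Bool using (true; false; not; _xor_)
open import Data.Bool.Properties using (not-involutive; not-injective; not-¬)
open import Data.Product using (_,_; ∃-syntax)
open import Data.Sum using (_⊎_; inj₁; inj₂)
open import Data.Fin using (zero; _↑ˡ_; _↑ʳ_; fromℕ<)
open import Data.Fin.Properties using (toℕ-↑ˡ; toℕ-↑ʳ; toℕ-fromℕ<)
open import Data.Vec.Properties using (lookup-++ˡ; lookup-++ʳ)
open import Induction.WellFounded using (Acc; acc)
open import Relation.Binary.PropositionalEquality using (refl; sym; trans; cong; cong₂; subst; module ≡-Reasoning)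

open ≡-Reasoning

data Halving : ℕ → Set where
  even : ∀ a → Halving (a * 2)
  odd  : ∀ a → Halving (suc (a * 2))

halve : ∀ n → Halving n
halve zero = even zero
halve (suc n) with halve n
... | even a = odd a
... | odd a  = even (suc a)

n*2≡n+n : ∀ n → n * 2 ≡ n + n
n*2≡n+n n = trans (*-comm n 2) (cong (n +_) (+-identityʳ n))

bit-even : ∀ a → bit (a * 2) ≡ false
bit-even zero    = refl
bit-even (suc a) = bit-even a

bit-odd : ∀ a → bit (suc (a * 2)) ≡ true
bit-odd zero    = refl
bit-odd (suc a) = bit-odd a

suc[a*2]/2≡a : ∀ a → suc (a * 2) / 2 ≡ a
suc[a*2]/2≡a a = trans (+-distrib-/-∣ʳ 1 {d = 2} (divides-refl a)) (m*n/n≡m a 2)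

parity⁺ parity⁻ : ℕ → ℕ → Bool
parity⁺ k n = parityOnes (posDigits k n)
parity⁻ k m = parityOnes (negDigits k m)

parity⁺-zero : ∀ k → parity⁺ k 0 ≡ false
parity⁺-zero zero    = refl
parity⁺-zero (suc k) = refl

parity⁻-zero : ∀ k → parity⁻ k 0 ≡ false
parity⁻-zero zero    = refl
parity⁻-zero (suc k) = refl

parity⁺-even : ∀ k a → parity⁺ (suc k) (a * 2) ≡ parity⁻ k a
parity⁺-even k zero      = sym (parity⁻-zero k)
parity⁺-even k a@(suc _) = cong₂ _xor_ (bit-even a) (cong (parity⁻ k) (m*n/n≡m a 2))

parity⁺-odd : ∀ k a → parity⁺ (suc k) (suc (a * 2)) ≡ not (parity⁻ k a)
parity⁺-odd k a = cong₂ _xor_ (bit-odd a) (cong (parity⁻ k) (suc[a*2]/2≡a a))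

parity⁻-even : ∀ k a → parity⁻ (suc k) (a * 2) ≡ parity⁺ k a
parity⁻-even k zero      = sym (parity⁺-zero k)
parity⁻-even k a@(suc _) = cong₂ _xor_ (bit-even a) (cong (parity⁺ k) half)
  where
  half : (a * 2 + a * 2 % 2) / 2 ≡ a
  half = begin
    (a * 2 + a * 2 % 2) / 2  ≡⟨ cong (λ r → (a * 2 + r) / 2) (m*n%n≡0 a 2) ⟩
    (a * 2 + 0) / 2          ≡⟨ cong (_/ 2) (+-identityʳ (a * 2)) ⟩
    a * 2 / 2                ≡⟨ m*n/n≡m a 2 ⟩
    a                        ∎

parity⁻-odd : ∀ k a → parity⁻ (suc k) (suc (a * 2)) ≡ not (parity⁺ k (suc a))
parity⁻-odd k a = cong₂ _xor_ (bit-odd a) (cong (parity⁺ k) half)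
  where
  half : (suc (a * 2) + suc (a * 2) % 2) / 2 ≡ suc a
  half = begin
    (suc (a * 2) + suc (a * 2) % 2) / 2  ≡⟨ cong (λ r → (suc (a * 2) + r) / 2) ([m+kn]%n≡m%n 1 a 2) ⟩
    (suc (a * 2) + 1) / 2                ≡⟨ cong (_/ 2) (+-comm (suc (a * 2)) 1) ⟩
    suc a * 2 / 2                        ≡⟨ m*n/n≡m (suc a) 2 ⟩
    suc a                                ∎

-- The bounds differ because the step −1 = 1 + (−2)·1 does not shrink m = 1.
parity⁺-fuel : ∀ {k k′} n → n * 2 ≤ suc k → n * 2 ≤ suc k′ → parity⁺ k n ≡ parity⁺ k′ n
parity⁻-fuel : ∀ {k k′} m → m * 2 ≤ k → m * 2 ≤ k′ → parity⁻ k m ≡ parity⁻ k′ m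

parity⁺-fuel n b b′ with halve n
parity⁺-fuel {k} {k′} _ _ _ | even zero = trans (parity⁺-zero k) (sym (parity⁺-zero k′))
parity⁺-fuel {zero} _ (s≤s ()) _ | even (suc _)
parity⁺-fuel {suc _} {zero} _ _ (s≤s ()) | even (suc _)
parity⁺-fuel {suc j} {suc j′} _ (s≤s (s≤s b)) (s≤s (s≤s b′)) | even a@(suc c) = begin
  parity⁺ (suc j) (a * 2)   ≡⟨ parity⁺-even j a ⟩
  parity⁻ j a               ≡⟨ parity⁻-fuel a (bound b) (bound b′) ⟩
  parity⁻ j′ a              ≡⟨ parity⁺-even j′ a ⟨
  parity⁺ (suc j′) (a * 2)  ∎
  where
  bound : ∀ {i} → suc (suc (c * 2 * 2)) ≤ i → a * 2 ≤ i
  bound = ≤-trans (s≤s (s≤s (m≤m*n (c * 2) 2)))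
parity⁺-fuel {zero} _ (s≤s ()) _ | odd _
parity⁺-fuel {suc _} {zero} _ _ (s≤s ()) | odd _
parity⁺-fuel {suc j} {suc j′} _ (s≤s (s≤s b)) (s≤s (s≤s b′)) | odd a = begin
  parity⁺ (suc j) (suc (a * 2))   ≡⟨ parity⁺-odd j a ⟩
  not (parity⁻ j a)               ≡⟨ cong not (parity⁻-fuel a (bound b) (bound b′)) ⟩
  not (parity⁻ j′ a)              ≡⟨ parity⁺-odd j′ a ⟨
  parity⁺ (suc j′) (suc (a * 2))  ∎
  where
  bound : ∀ {i} → a * 2 * 2 ≤ i → a * 2 ≤ i
  bound = ≤-trans (m≤m*n (a * 2) 2)

parity⁻-fuel m b b′ with halve m
parity⁻-fuel {k} {k′} _ _ _ | even zero = trans (parity⁻-zero k) (sym (parity⁻-zero k′))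
parity⁻-fuel {suc j} {suc j′} _ (s≤s b) (s≤s b′) | even a@(suc c) = begin
  parity⁻ (suc j) (a * 2)   ≡⟨ parity⁻-even j a ⟩
  parity⁺ j a               ≡⟨ parity⁺-fuel a (bound b) (bound b′) ⟩
  parity⁺ j′ a              ≡⟨ parity⁻-even j′ a ⟨
  parity⁻ (suc j′) (a * 2)  ∎
  where
  bound : ∀ {i} → suc (suc (suc (c * 2 * 2))) ≤ i → a * 2 ≤ suc i
  bound b = s≤s (≤-trans (s≤s (m≤m*n (c * 2) 2)) (m+n≤o⇒n≤o 2 b))
parity⁻-fuel {suc j} {suc j′} _ (s≤s b) (s≤s b′) | odd a = begin
  parity⁻ (suc j) (suc (a * 2))   ≡⟨ parity⁻-odd j a ⟩
  not (parity⁺ j (suc a))         ≡⟨ cong not (parity⁺-fuel (suc a) (bound b) (bound b′)) ⟩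
  not (parity⁺ j′ (suc a))        ≡⟨ parity⁻-odd j′ a ⟨
  parity⁻ (suc j′) (suc (a * 2))  ∎
  where
  bound : ∀ {i} → suc (a * 2 * 2) ≤ i → suc a * 2 ≤ suc i
  bound b = s≤s (≤-trans (s≤s (m≤m*n (a * 2) 2)) b)

-- Digit parity of the negabinary representation of −m (with enough fuel, by parity⁻-fuel).
g⁻ : ℕ → Bool
g⁻ m = parity⁻ (m * 2) m

parity⁺≡g : ∀ {k} n → n * 2 ≤ suc k → parity⁺ k n ≡ g n
parity⁺≡g n b = parity⁺-fuel n b (≤-trans (≤-reflexive (n*2≡n+n n)) (m≤n+m _ 2))

parity⁻≡g⁻ : ∀ {k} m → m * 2 ≤ k → parity⁻ k m ≡ g⁻ m
parity⁻≡g⁻ m b = parity⁻-fuel m b ≤-refl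

g-even : ∀ a → g (a * 2) ≡ g⁻ a
g-even a = trans (parity⁺-even _ a) (parity⁻≡g⁻ a (m≤m+n _ _))

g-odd : ∀ a → g (suc (a * 2)) ≡ not (g⁻ a)
g-odd a = trans (parity⁺-odd (suc (a * 2) + suc (a * 2)) a)
                (cong not (parity⁻≡g⁻ a (≤-trans (n≤1+n _) (m≤m+n _ _))))

g⁻-even : ∀ a → g⁻ (a * 2) ≡ g a
g⁻-even zero      = refl
g⁻-even a@(suc c) = trans (parity⁻-even _ a)
                          (parity⁺≡g a (s≤s (s≤s (≤-trans (m≤m*n (c * 2) 2) (m≤n+m _ 2)))))

g⁻-odd : ∀ a → g⁻ (suc (a * 2)) ≡ not (g (suc a))
g⁻-odd a = trans (parity⁻-odd _ a) (cong not (parity⁺≡g (suc a) (s≤s (s≤s (m≤m*n (a * 2) 2)))))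

-- S is the image of T under the Thue–Morse substitution b ↦ b (not b), with the
-- complemented letters read e places ahead.
record Doubling (S T : ℕ → Bool) (e : ℕ) : Set where
  field
    at-even : ∀ n → S (n * 2) ≡ T n
    at-odd  : ∀ n → S (suc (n * 2)) ≡ not (T (e + n))

g-doubling : Doubling g g⁻ 0
g-doubling = record { at-even = g-even ; at-odd = g-odd }

g⁻-doubling : Doubling g⁻ g 1
g⁻-doubling = record { at-even = g⁻-even ; at-odd = g⁻-odd }

-- The block S[p .. p + 2L] has period L: it is an overlap a x a x a with |a x| = L.
Overlap : {A : Set} → (ℕ → A) → ℕ → ℕ → Set
Overlap S p L = ∀ i → i ≤ L → S (p + i) ≡ S (p + i + L)

FlipsAt : (ℕ → Bool) → ℕ → Set
FlipsAt S n = S (suc n) ≡ not (S n)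

module _ {S T : ℕ → Bool} where

  flips-even : Doubling S T 0 → ∀ a → FlipsAt S (a * 2)
  flips-even D a = trans (at-odd a) (cong not (sym (at-even a)))
    where open Doubling D

  flips-odd : Doubling S T 1 → ∀ a → FlipsAt S (suc (a * 2))
  flips-odd D a = begin
    S (suc a * 2)              ≡⟨ at-even (suc a) ⟩
    T (suc a)                  ≡⟨ not-involutive _ ⟨
    not (not (T (suc a)))      ≡⟨ cong not (at-odd a) ⟨
    not (S (suc (a * 2)))      ∎
    where open Doubling D

  -- n and n + suc (t * 2) have different parities, so one of them starts a block b (not b).
  flips-here-or-across : ∀ {e} → Doubling S T e → e ≤ 1 →
                         ∀ t n → FlipsAt S n ⊎ FlipsAt S (n + suc (t * 2))
  flips-here-or-across D e≤1 t n with e≤1 | halve n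
  ... | z≤n     | even a = inj₁ (flips-even D a)
  ... | z≤n     | odd a  = inj₂ (subst (FlipsAt S) (across a t) (flips-even D (suc (a + t))))
    where
    across : ∀ a t → suc (a + t) * 2 ≡ suc (a * 2) + suc (t * 2)
    across = solve-∀
  ... | s≤s z≤n | even a = inj₂ (subst (FlipsAt S) (across a t) (flips-odd D (a + t)))
    where
    across : ∀ a t → suc ((a + t) * 2) ≡ a * 2 + suc (t * 2)
    across = solve-∀
  ... | s≤s z≤n | odd a  = inj₁ (flips-odd D a)

overlap-flips : ∀ {S p L} → Overlap S p L → (∀ n → FlipsAt S n ⊎ FlipsAt S (n + L)) →
                ∀ i → i < L → FlipsAt (λ j → S (p + j)) i
overlap-flips {S} {p} {L} ov flips i i<L with flips (p + i)
... | inj₁ here   = trans (cong S (+-suc p i)) here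
... | inj₂ across = begin
  S (p + suc i)          ≡⟨ ov (suc i) i<L ⟩
  S (p + suc i + L)      ≡⟨ cong (λ x → S (x + L)) (+-suc p i) ⟩
  S (suc (p + i + L))    ≡⟨ across ⟩
  not (S (p + i + L))    ≡⟨ cong not (ov i (<⇒≤ i<L)) ⟨
  not (S (p + i))        ∎

flips-twice : ∀ {S n} → FlipsAt S n → FlipsAt S (suc n) → S (suc (suc n)) ≡ S n
flips-twice f f′ = trans f′ (trans (cong not f) (not-involutive _))

alternating-odd : ∀ {S} t → (∀ i → i < suc (t * 2) → FlipsAt S i) → S (suc (t * 2)) ≡ not (S 0)
alternating-odd zero    flips = flips 0 z<s
alternating-odd {S} (suc t) flips =
  trans (flips-twice {S} (flips _ (n≤1+n _)) (flips _ ≤-refl))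
        (alternating-odd t (λ i i< → flips i (≤-trans i< (m≤n+m _ 2))))

¬odd-period-overlap : ∀ {S T e} → Doubling S T e → e ≤ 1 → ∀ p t → ¬ Overlap S p (suc (t * 2))
¬odd-period-overlap {S} D e≤1 p t ov = not-¬ refl (begin
  S (p + 0)        ≡⟨ ov 0 z≤n ⟩
  S (p + 0 + L)    ≡⟨ cong (λ x → S (x + L)) (+-identityʳ p) ⟩
  S (p + L)        ≡⟨ alternating-odd t (overlap-flips ov (flips-here-or-across D e≤1 t)) ⟩
  not (S (p + 0))  ∎)
  where
  L = suc (t * 2)

stride-two : ∀ {S T e} → Doubling S T e → ∀ p →
             ∃[ q ] (∀ i j → S (p + i * 2) ≡ S (p + j * 2) → T (q + i) ≡ T (q + j))
stride-two {S} {T} {e} D p with halve p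
... | even c = c , λ i j eq → trans (sym (at i)) (trans eq (at j))
  where
  open Doubling D
  at : ∀ i → S (c * 2 + i * 2) ≡ T (c + i)
  at i = trans (cong S (sym (*-distribʳ-+ 2 c i))) (at-even (c + i))
... | odd c = e + c , λ i j eq → not-injective (trans (sym (at i)) (trans eq (at j)))
  where
  open Doubling D
  at : ∀ i → S (suc (c * 2) + i * 2) ≡ not (T (e + c + i))
  at i = begin
    S (suc (c * 2 + i * 2))  ≡⟨ cong (λ x → S (suc x)) (*-distribʳ-+ 2 c i) ⟨
    S (suc ((c + i) * 2))    ≡⟨ at-odd (c + i) ⟩
    not (T (e + (c + i)))    ≡⟨ cong (λ x → not (T x)) (+-assoc e c i) ⟨
    not (T (e + c + i))      ∎

overlap-half : ∀ {S T e} → Doubling S T e → ∀ p a → Overlap S p (a * 2) → ∃[ q ] Overlap T q a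
overlap-half {S} {T} D p a ov with stride-two D p
... | q , transfer = q , λ i i≤a → trans (transfer i (i + a) (shifted i i≤a)) (cong T (sym (+-assoc q i a)))
  where
  shifted : ∀ i → i ≤ a → S (p + i * 2) ≡ S (p + (i + a) * 2)
  shifted i i≤a = begin
    S (p + i * 2)            ≡⟨ ov (i * 2) (*-monoˡ-≤ 2 i≤a) ⟩
    S (p + i * 2 + a * 2)    ≡⟨ cong S (+-assoc p (i * 2) (a * 2)) ⟩
    S (p + (i * 2 + a * 2))  ≡⟨ cong (λ x → S (p + x)) (*-distribʳ-+ 2 i a) ⟨
    S (p + (i + a) * 2)      ∎

mutual-doubling⇒overlap-free : ∀ {L} → Acc _<_ L → 0 < L →
  ∀ {S T e e′} → Doubling S T e → Doubling T S e′ → e ≤ 1 → e′ ≤ 1 → ∀ p → ¬ Overlap S p L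
mutual-doubling⇒overlap-free {L} (acc smaller) 0<L D D′ e≤1 e′≤1 p ov with halve L
... | odd t = ¬odd-period-overlap D e≤1 p t ov
... | even a@(suc _) with overlap-half D p a ov
...   | q , ov′ = mutual-doubling⇒overlap-free (smaller (m<m*n a 2 ≤-refl)) z<s D′ D e′≤1 e≤1 q ov′

g-overlap-free : ∀ p L → 0 < L → ¬ Overlap g p L
g-overlap-free p L 0<L =
  mutual-doubling⇒overlap-free (<-wellFounded L) 0<L g-doubling g⁻-doubling z≤n ≤-refl p

module _ {A : Set} {S : ℕ → A} (m : ℕ) (X : Vec A (suc m)) (p : ℕ)
         (cube : ∀ (i : Fin (suc m + (suc m + suc m))) → S (p + toℕ i) ≡ lookup (X ++ (X ++ X)) i)
         where
  private
    L = suc m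

    at : ∀ k {n} → toℕ k ≡ n → S (p + n) ≡ lookup (X ++ (X ++ X)) k
    at k refl = cube k

    first : ∀ j → S (p + toℕ j) ≡ lookup X j
    first j = trans (at (j ↑ˡ (L + L)) (toℕ-↑ˡ j _)) (lookup-++ˡ X _ j)

    second : ∀ j → S (p + (L + toℕ j)) ≡ lookup X j
    second j = trans (at (L ↑ʳ (j ↑ˡ L)) (trans (toℕ-↑ʳ L _) (cong (L +_) (toℕ-↑ˡ j L))))
                     (trans (lookup-++ʳ X _ (j ↑ˡ L)) (lookup-++ˡ X X j))

    third : ∀ j → S (p + (L + (L + toℕ j))) ≡ lookup X j
    third j = trans (at (L ↑ʳ (L ↑ʳ j)) (trans (toℕ-↑ʳ L _) (cong (L +_) (toℕ-↑ʳ L j))))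
                    (trans (lookup-++ʳ X _ (L ↑ʳ j)) (lookup-++ʳ X X j))

  cube⇒overlap : Overlap S p (suc m)
  cube⇒overlap i i≤L with m≤n⇒m<n∨m≡n i≤L
  ... | inj₁ i<L = begin
    S (p + i)              ≡⟨ cong (λ x → S (p + x)) (toℕ-fromℕ< i<L) ⟨
    S (p + toℕ j)          ≡⟨ first j ⟩
    lookup X j             ≡⟨ second j ⟨
    S (p + (L + toℕ j))    ≡⟨ cong (λ x → S (p + (L + x))) (toℕ-fromℕ< i<L) ⟩
    S (p + (L + i))        ≡⟨ cong (λ x → S (p + x)) (+-comm L i) ⟩
    S (p + (i + L))        ≡⟨ cong S (+-assoc p i L) ⟨
    S (p + i + L)          ∎
    where
    j = fromℕ< i<L
  ... | inj₂ refl = begin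
    S (p + L)              ≡⟨ cong (λ x → S (p + x)) (+-identityʳ L) ⟨
    S (p + (L + 0))        ≡⟨ second zero ⟩
    lookup X zero          ≡⟨ third zero ⟨
    S (p + (L + (L + 0)))  ≡⟨ cong (λ x → S (p + (L + x))) (+-identityʳ L) ⟩
    S (p + (L + L))        ≡⟨ cong S (+-assoc p L L) ⟨
    S (p + L + L)          ∎

theorem5 : (m : ℕ) (X : Vec Bool (suc m)) (p : ℕ) → ¬ (∀ (i : Fin (suc m + (suc m + suc m))) → g (p + toℕ i) ≡ lookup (X ++ (X ++ X)) i)
theorem5 m X p cube = g-overlap-free p (suc m) z<s (cube⇒overlap {S = g} m X p cube)
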